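{- Let $\Gamma$ be an abelian group written additively, $\varphi$ a $\Gamma$-gain function on a finite graph $G$, and $e$ an edge of $G$ that is not an isthmus. Then there is a $\Gamma$-gain function $\psi$ on $G$, shifting equivalent to $\varphi$, with $\psi(e)=0$ and $\mathcal L_\varphi\setminus e=\mathcal L_\psi\setminus e=\mathcal L_{\psi\setminus e}$, where $\psi\setminus e$ is the restriction of $\psi$ to $G\setminus e$.
   Context: A bond is a minimal nonempty edge cut; $\delta(X)$ is the set of non-loop edges with exactly one endpoint in a vertex set $X$. An oriented bond $\vec B$ is a bond $\delta(X)$ with all edges oriented away from $X$ or all towards $X$. A $\Gamma$-gain function assigns to each oriented edge $e$ a value $\varphi(e)\in\Gamma$ with $\varphi(-e)=-\varphi(e)$; $\varphi(\vec B)=\sum_{e\in\vec B}\varphi(e)$; a bond is cobalanced if $\varphi(\vec B)=0$, and $\mathcal L_\varphi$ is the set of cobalanced bonds. For a cycle $C$ with oriented edges $e_1,\dots,e_k$ in cyclic order and $a\in\Gamma$, $\psi_{C,a}$ is the gain function equal to $a$ on each $e_i$ and $0$ off $C$; a shift replaces $\varphi$ by $\varphi+\psi_{C,a}$, and gain functions are shifting equivalent if related by a finite sequence of shifts. For a set $\mathcal L$ of bonds of $G$, $\mathcal L\setminus e$ is the set of bonds $B$ of $G\setminus e$ such that $B\in\mathcal L$ or $B\cup\{e\}\in\mathcal L$ (for each bond $B$ of $G\setminus e$, exactly one of $B$, $B\cup\{e\}$ is a bond of $G$). -}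

module Defs where

open import Level using (Level)
open import Data.Nat as ℕ using (ℕ; zero; suc)
open import Data.Nat.DivMod using (_%_; m%n<n)
open import Data.Bool using (Bool; true; false; if_then_else_; _xor_)
open import Data.Fin using (Fin; toℕ; fromℕ<; punchIn; _≟_)
open import Data.Fin.Subset using (Subset; _∈_; _⊆_; Nonempty)
open import Data.Vec using (Vec; lookup; tabulate; insertAt)
open import Data.Product using (Σ; _×_; ∃)
open import Data.Sum using (_⊎_)
open import Function using (_∘_; _⇔_; Injective)
open import Relation.Nullary using (¬_; yes; no)
open import Relation.Binary.PropositionalEquality using (_≡_)
open import Relation.Binary.Construct.Closure.ReflexiveTransitive using (Star)
open import Algebra.Bundles using (AbelianGroup)

-- Finite graphs (multigraphs, loops allowed): vertices Fin n, edges Fin m,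
-- each edge carries a reference orientation tl e → hd e.

record Graph (n m : ℕ) : Set where
  field
    tl hd : Fin m → Fin n
open Graph public

δ : ∀ {n m} → Graph n m → Subset n → Subset m
δ G X = tabulate λ e → lookup X (tl G e) xor lookup X (hd G e)

IsCut : ∀ {n m} → Graph n m → Subset m → Set
IsCut {n} G B = Σ (Subset n) λ X → B ≡ δ G X

Bond : ∀ {n m} → Graph n m → Subset m → Set
Bond G B = IsCut G B × Nonempty B
         × (∀ B′ → IsCut G B′ → Nonempty B′ → B′ ⊆ B → B′ ≡ B)

Isthmus : ∀ {n m} → Graph n m → Fin m → Set
Isthmus {m = m} G e = Bond G (tabulate λ f → if ⌊ f ≟ e ⌋′ then true else false)
  where
  open import Relation.Nullary.Decidable using () renaming (⌊_⌋ to ⌊_⌋′)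

_∖ᴳ_ : ∀ {n m} → Graph n (suc m) → Fin (suc m) → Graph n m
G ∖ᴳ e = record { tl = tl G ∘ punchIn e ; hd = hd G ∘ punchIn e }

_∖ᴸ_ : ∀ {m} {p} → (Subset (suc m) → Set p) → Fin (suc m) → Subset m → Set p
(L ∖ᴸ e) B = L (insertAt B e false) ⊎ L (insertAt B e true)

DelBonds : ∀ {n m} {p} → Graph n (suc m) → (Subset (suc m) → Set p)
         → Fin (suc m) → Subset m → Set p
DelBonds G L e B = Bond (G ∖ᴳ e) B × (L ∖ᴸ e) B

next : ∀ {k} → Fin (suc k) → Fin (suc k)
next {k} i = fromℕ< (m%n<n (suc (toℕ i)) (suc k))

-- a cycle of length suc k: distinct vertices v 0 … v k, distinct edges
-- es 0 … es k, with oriented edge i going from v i to v (next i);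
-- dir i = true means es i is traversed along its reference orientation.
record Cycle {n m} (G : Graph n m) : Set where
  field
    len   : ℕ
    v     : Fin (suc len) → Fin n
    es    : Fin (suc len) → Fin m
    dir   : Fin (suc len) → Bool
    v-inj  : Injective _≡_ _≡_ v
    es-inj : Injective _≡_ _≡_ es
    along  : ∀ i → dir i ≡ true  → tl G (es i) ≡ v i × hd G (es i) ≡ v (next i)
    against : ∀ i → dir i ≡ false → hd G (es i) ≡ v i × tl G (es i) ≡ v (next i)
open Cycle public

module GainDefs {c ℓ} (Γ : AbelianGroup c ℓ) where
  open AbelianGroup Γ renaming (Carrier to A; _∙_ to _+_; ε to 0#; _⁻¹ to -_)

  ∑ : ∀ {k} → (Fin k → A) → A
  ∑ {zero}  f = 0#
  ∑ {suc k} f = f Fin.zero + ∑ (f ∘ Fin.suc)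
    where import Data.Fin as Fin

  -- a Γ-gain function, given by its value on the reference orientation of
  -- each edge; the value on the reversed edge is the negative.
  Gain : ℕ → Set c
  Gain m = Fin m → A

  -- φ(B⃗) for B = δ(X), every edge oriented away from X
  awaySum : ∀ {n m} → Graph n m → Gain m → Subset n → A
  awaySum G φ X = ∑ λ e →
    if lookup (δ G X) e
      then (if lookup X (tl G e) then φ e else - φ e)
      else 0#

  Cobalanced : ∀ {n m} → Graph n m → Gain m → Subset m → Set ℓ
  Cobalanced {n} G φ B = Σ (Subset n) λ X → B ≡ δ G X × awaySum G φ X ≈ 0#

  𝓛 : ∀ {n m} → Graph n m → Gain m → Subset m → Set ℓ
  𝓛 G φ B = Bond G B × Cobalanced G φ B

  cycGain : ∀ {n m} {G : Graph n m} → Cycle G → A → Gain m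
  cycGain C a e = ∑ λ i →
    if ⌊ es C i ≟ e ⌋′ then (if dir C i then a else - a) else 0#
    where open import Relation.Nullary.Decidable using () renaming (⌊_⌋ to ⌊_⌋′)

  ShiftStep : ∀ {n m} → Graph n m → Gain m → Gain m → Set (c Level.⊔ ℓ)
  ShiftStep G φ φ′ = Σ (Cycle G) λ C → Σ A λ a → ∀ e → φ′ e ≈ φ e + cycGain C a e

  ShiftEquiv : ∀ {n m} → Graph n m → Gain m → Gain m → Set (c Level.⊔ ℓ)
  ShiftEquiv G = Star (ShiftStep G)

  restrict : ∀ {m} → Gain (suc m) → Fin (suc m) → Gain m
  restrict ψ e = ψ ∘ punchIn e

_≐_ : ∀ {m p q} → (Subset m → Set p) → (Subset m → Set q) → Set _
P ≐ Q = ∀ B → P B ⇔ Q B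

-- Since e is not an isthmus, G ∖ e contains a path from hd e to tl e: otherwise the set of
-- vertices reachable from tl e in G ∖ e would be a vertex set whose cut in G is {e}.
-- Closing the path with e gives a cycle C through e, and shifting φ by −φ(e) along C yields
-- ψ with ψ(e) = 0. A shift changes no value φ(B⃗), because every edge of C contributes
-- [its tail ∈ X] − [its head ∈ X] to the cut δ(X) and these terms telescope around C.
-- Once ψ(e) = 0, the cut δ(X) of G and its trace on G ∖ e carry the same ψ-value; and if the
-- trace is a bond of G ∖ e then δ(X) is a bond of G, because two cuts of G agreeing off a
-- non-isthmus e agree at e (their symmetric difference would be a cut equal to {e}).
module Submission where

open import Level using (Level)
open import Defs
open import Data.Nat using (ℕ; zero; suc; s≤s; _%_)
open import Data.Nat.DivMod using (n%n≡0; m<n⇒m%n≡m)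
open import Data.Bool using (Bool; true; false; _xor_; if_then_else_)
import Data.Bool as Bool
open import Data.Bool.Properties using (xor-same; xor-inverseʳ; ¬-not; xor-∧-commutativeRing)
open import Data.Fin using (Fin; fromℕ; inject₁; toℕ; punchIn; _≟_)
open import Data.Fin.Properties
  using (toℕ-injective; toℕ-fromℕ<; toℕ-fromℕ; toℕ-inject₁; toℕ<n; punchIn-injective; punchInᵢ≢i)
open import Data.Fin.Relation.Unary.Top using (view; ‵fromℕ; ‵inj₁; view-fromℕ)
open import Data.Fin.Subset using (Subset; _∈_; _∉_; _⊆_; _⊃_; _∪_; Nonempty; ⊥; ⁅_⁆; inside; outside)
open import Data.Fin.Subset.Properties
  using (x∈⁅x⁆; x∈⁅y⁆⇒x≡y; ∉⊥; ⊆-antisym; p⊆p∪q; q⊆p∪q; x∈p∪q⁻; _∈?_; nonempty?; Empty-unique)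
open import Data.Fin.Subset.Induction using (⊃-wellFounded; Acc; acc)
open import Data.Vec using (Vec; _∷_; lookup; tabulate; insertAt; removeAt; zipWith)
open import Data.Vec.Properties
  using (lookup∘tabulate; lookup-replicate; lookup-zipWith; insertAt-punchIn; insertAt-removeAt; removeAt-insertAt;
         []=⇒lookup; lookup⇒[]=)
open import Data.Vec.Relation.Binary.Pointwise.Extensional using (ext; Pointwise-≡⇒≡)
import Data.Vec.Functional as Vector
open import Data.Product using (Σ; _×_; _,_; proj₁; proj₂)
open import Data.Sum using (_⊎_; inj₁; inj₂)
import Data.Sum as Sum
open import Function using (Injective; _∘_; _⇔_; Equivalence)
open import Function.Bundles using (mk⇔)
open import Relation.Nullary using (¬_; yes; no; contradiction)
open import Relation.Nullary.Decidable using (⌊_⌋; isYes≗does; dec-true; dec-false)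
open import Relation.Binary.PropositionalEquality
  using (_≡_; _≢_; refl; sym; trans; cong; cong₂; subst; module ≡-Reasoning)
open import Relation.Binary.Construct.Closure.ReflexiveTransitive using (_◅_; ε)
open import Algebra.Bundles using (AbelianGroup; CommutativeRing)
open import Algebra.Properties.CommutativeSemigroup (CommutativeRing.+-commutativeSemigroup xor-∧-commutativeRing)
  using () renaming (interchange to xor-interchange)
import Algebra.Properties.AbelianGroup as AbelianGroupProperties
import Algebra.Properties.CommutativeMonoid.Sum as CommutativeMonoidSum
import Relation.Binary.Reasoning.Setoid as SetoidReasoning

private
  variable
    a : Level
    T : Set a
    k n m : ℕ

lookup-removeAt : (xs : Vec T (suc m)) (i : Fin (suc m)) (j : Fin m) →
                  lookup (removeAt xs i) j ≡ lookup xs (punchIn i j)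
lookup-removeAt xs i j = begin
  lookup (removeAt xs i) j                                         ≡⟨ insertAt-punchIn (removeAt xs i) i (lookup xs i) j ⟨
  lookup (insertAt (removeAt xs i) i (lookup xs i)) (punchIn i j) ≡⟨ cong (λ ys → lookup ys (punchIn i j)) (insertAt-removeAt xs i) ⟩
  lookup xs (punchIn i j)                                          ∎
  where open ≡-Reasoning

insertAt-⊥ : (e : Fin (suc m)) → insertAt ⊥ e inside ≡ ⁅ e ⁆
insertAt-⊥ Fin.zero = refl
insertAt-⊥ {suc m} (Fin.suc e) = cong (outside ∷_) (insertAt-⊥ e)

⁅⁆≡tabulate : (e : Fin m) → ⁅ e ⁆ ≡ tabulate (λ f → if ⌊ f ≟ e ⌋ then true else false)
⁅⁆≡tabulate e = Pointwise-≡⇒≡ (ext λ f → trans (lookup-⁅⁆ f) (sym (lookup∘tabulate _ f)))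
  where
  lookup-⁅⁆ : ∀ f → lookup ⁅ e ⁆ f ≡ (if ⌊ f ≟ e ⌋ then true else false)
  lookup-⁅⁆ f with f ≟ e
  ... | yes refl = []=⇒lookup (x∈⁅x⁆ f)
  ... | no f≢e   = ¬-not (λ f∈⁅e⁆ → f≢e (x∈⁅y⁆⇒x≡y e (lookup⇒[]= f ⁅ e ⁆ f∈⁅e⁆)))

lookup≡false⇒∉ : {R : Subset n} {x : Fin n} → lookup R x ≡ false → x ∉ R
lookup≡false⇒∉ x∉R x∈R = contradiction (trans (sym ([]=⇒lookup x∈R)) x∉R) λ ()

zipWith-xor-self : (B : Subset m) → zipWith _xor_ B B ≡ ⊥
zipWith-xor-self B = Pointwise-≡⇒≡ (ext λ f →
  trans (lookup-zipWith _xor_ f B B) (trans (xor-same (lookup B f)) (sym (lookup-replicate f outside))))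

xor-≢ : ∀ {b c} → b ≢ c → b xor c ≡ true
xor-≢ {b} b≢c = trans (cong (b xor_) (¬-not (b≢c ∘ sym))) (xor-inverseʳ b)

if-≟-refl : (i : Fin k) {x y : T} → (if ⌊ i ≟ i ⌋ then x else y) ≡ x
if-≟-refl i {x} {y} = cong (λ b → if b then x else y) (trans (isYes≗does (i ≟ i)) (dec-true (i ≟ i) refl))

if-≟-≢ : {i j : Fin k} {x y : T} → i ≢ j → (if ⌊ i ≟ j ⌋ then x else y) ≡ y
if-≟-≢ {i = i} {j} {x} {y} i≢j =
  cong (λ b → if b then x else y) (trans (isYes≗does (i ≟ j)) (dec-false (i ≟ j) i≢j))

∷-injective : ∀ {x} {xs : Fin k → T} → Injective _≡_ _≡_ xs → (∀ i → xs i ≢ x) →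
              Injective _≡_ _≡_ (x Vector.∷ xs)
∷-injective xs-inj fresh {Fin.zero}  {Fin.zero}  _  = refl
∷-injective xs-inj fresh {Fin.zero}  {Fin.suc j} eq = contradiction (sym eq) (fresh j)
∷-injective xs-inj fresh {Fin.suc i} {Fin.zero}  eq = contradiction eq (fresh i)
∷-injective xs-inj fresh {Fin.suc i} {Fin.suc j} eq = cong Fin.suc (xs-inj eq)

_∷ʳ_ : (Fin k → T) → T → Fin (suc k) → T
(xs ∷ʳ x) i with view i
... | ‵fromℕ          = x
... | ‵inj₁ {i = j} _ = xs j

∷ʳ-last : (xs : Fin k → T) (x : T) → (xs ∷ʳ x) (fromℕ k) ≡ x
∷ʳ-last {k} xs x rewrite view-fromℕ k = refl

∷ʳ-injective : ∀ {x} {xs : Fin k → T} → Injective _≡_ _≡_ xs → (∀ i → xs i ≢ x) →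
               Injective _≡_ _≡_ (xs ∷ʳ x)
∷ʳ-injective xs-inj fresh {i} {j} eq with view i | view j
... | ‵fromℕ           | ‵fromℕ           = refl
... | ‵fromℕ           | ‵inj₁ {i = j′} _ = contradiction (sym eq) (fresh j′)
... | ‵inj₁ {i = i′} _ | ‵fromℕ           = contradiction eq (fresh i′)
... | ‵inj₁ _          | ‵inj₁ _          = cong inject₁ (xs-inj eq)

next-fromℕ : ∀ k → next (fromℕ k) ≡ Fin.zero
next-fromℕ k = toℕ-injective (begin
  toℕ (next (fromℕ k))        ≡⟨ toℕ-fromℕ< _ ⟩
  suc (toℕ (fromℕ k)) % suc k ≡⟨ cong (λ i → suc i % suc k) (toℕ-fromℕ k) ⟩
  suc k % suc k               ≡⟨ n%n≡0 (suc k) ⟩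
  0                           ∎)
  where open ≡-Reasoning

next-inject₁ : (j : Fin k) → next (inject₁ j) ≡ Fin.suc j
next-inject₁ {k} j = toℕ-injective (begin
  toℕ (next (inject₁ j))        ≡⟨ toℕ-fromℕ< _ ⟩
  suc (toℕ (inject₁ j)) % suc k ≡⟨ cong (λ i → suc i % suc k) (toℕ-inject₁ j) ⟩
  suc (toℕ j) % suc k           ≡⟨ m<n⇒m%n≡m (s≤s (toℕ<n j)) ⟩
  suc (toℕ j)                   ∎)
  where open ≡-Reasoning

-- Cuts and deletion

δ-lookup : (G : Graph n m) (X : Subset n) (f : Fin m) →
           lookup (δ G X) f ≡ lookup X (tl G f) xor lookup X (hd G f)
δ-lookup G X f = lookup∘tabulate _ f

δ∖ᴳ-lookup : (G : Graph n (suc m)) (e : Fin (suc m)) (X : Subset n) (j : Fin m) →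
             lookup (δ (G ∖ᴳ e) X) j ≡ lookup (δ G X) (punchIn e j)
δ∖ᴳ-lookup G e X j = trans (δ-lookup (G ∖ᴳ e) X j) (sym (δ-lookup G X (punchIn e j)))

∈δ∖ᴳ⇔ : (G : Graph n (suc m)) (e : Fin (suc m)) (X : Subset n) (j : Fin m) →
        j ∈ δ (G ∖ᴳ e) X ⇔ punchIn e j ∈ δ G X
∈δ∖ᴳ⇔ G e X j = mk⇔
  (λ j∈ → lookup⇒[]= _ (δ G X) (trans (sym (δ∖ᴳ-lookup G e X j)) ([]=⇒lookup j∈)))
  (λ j∈ → lookup⇒[]= j _ (trans (δ∖ᴳ-lookup G e X j) ([]=⇒lookup j∈)))

δ∖ᴳ≡removeAt : (G : Graph n (suc m)) (e : Fin (suc m)) (X : Subset n) → δ (G ∖ᴳ e) X ≡ removeAt (δ G X) e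
δ∖ᴳ≡removeAt G e X = Pointwise-≡⇒≡ (ext λ j → trans (δ∖ᴳ-lookup G e X j) (sym (lookup-removeAt (δ G X) e j)))

δ≡insertAt-δ∖ᴳ : (G : Graph n (suc m)) (e : Fin (suc m)) (X : Subset n) →
                 δ G X ≡ insertAt (δ (G ∖ᴳ e) X) e (lookup (δ G X) e)
δ≡insertAt-δ∖ᴳ G e X = trans (sym (insertAt-removeAt (δ G X) e))
                             (cong (λ B → insertAt B e (lookup (δ G X) e)) (sym (δ∖ᴳ≡removeAt G e X)))

insertAt≡δ⇒≡δ∖ᴳ : (G : Graph n (suc m)) (e : Fin (suc m)) (B : Subset m) (b : Bool) (X : Subset n) →
                   insertAt B e b ≡ δ G X → B ≡ δ (G ∖ᴳ e) X
insertAt≡δ⇒≡δ∖ᴳ G e B b X eq =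
  trans (sym (removeAt-insertAt B e b)) (trans (cong (λ B′ → removeAt B′ e) eq) (sym (δ∖ᴳ≡removeAt G e X)))

δ-⊥ : (G : Graph n m) → δ G ⊥ ≡ ⊥
δ-⊥ G = Pointwise-≡⇒≡ (ext λ f → begin
  lookup (δ G ⊥) f                        ≡⟨ δ-lookup G ⊥ f ⟩
  lookup ⊥ (tl G f) xor lookup ⊥ (hd G f) ≡⟨ cong₂ _xor_ (lookup-replicate (tl G f) outside) (lookup-replicate (hd G f) outside) ⟩
  outside                                 ≡⟨ lookup-replicate f outside ⟨
  lookup ⊥ f                              ∎)
  where open ≡-Reasoning

δ-xor : (G : Graph n m) (X Y : Subset n) → δ G (zipWith _xor_ X Y) ≡ zipWith _xor_ (δ G X) (δ G Y)
δ-xor G X Y = Pointwise-≡⇒≡ (ext λ f → begin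
  lookup (δ G X⊕Y) f                                          ≡⟨ δ-lookup G X⊕Y f ⟩
  lookup X⊕Y (tl G f) xor lookup X⊕Y (hd G f)                 ≡⟨ cong₂ _xor_ (lookup-zipWith _xor_ (tl G f) X Y) (lookup-zipWith _xor_ (hd G f) X Y) ⟩
  (x (tl G f) xor y (tl G f)) xor (x (hd G f) xor y (hd G f)) ≡⟨ xor-interchange (x (tl G f)) (y (tl G f)) (x (hd G f)) (y (hd G f)) ⟩
  (x (tl G f) xor x (hd G f)) xor (y (tl G f) xor y (hd G f)) ≡⟨ cong₂ _xor_ (δ-lookup G X f) (δ-lookup G Y f) ⟨
  lookup (δ G X) f xor lookup (δ G Y) f                       ≡⟨ lookup-zipWith _xor_ f (δ G X) (δ G Y) ⟨
  lookup (zipWith _xor_ (δ G X) (δ G Y)) f                    ∎)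
  where
  open ≡-Reasoning
  X⊕Y = zipWith _xor_ X Y
  x = lookup X
  y = lookup Y

singleton-cut⇒bond : (G : Graph n m) (e : Fin m) → IsCut G ⁅ e ⁆ → Bond G ⁅ e ⁆
singleton-cut⇒bond G e cut = cut , (e , x∈⁅x⁆ e) , minimal
  where
  minimal : ∀ B → IsCut G B → Nonempty B → B ⊆ ⁅ e ⁆ → B ≡ ⁅ e ⁆
  minimal B _ (i , i∈B) B⊆⁅e⁆ = ⊆-antisym B⊆⁅e⁆ λ f∈⁅e⁆ →
    subst (_∈ B) (trans (x∈⁅y⁆⇒x≡y e (B⊆⁅e⁆ i∈B)) (sym (x∈⁅y⁆⇒x≡y e f∈⁅e⁆))) i∈B

isthmus-if-δ∖ᴳ≡⊥ : (G : Graph n (suc m)) (e : Fin (suc m)) (X : Subset n) →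
                   δ (G ∖ᴳ e) X ≡ ⊥ → lookup (δ G X) e ≡ true → Isthmus G e
isthmus-if-δ∖ᴳ≡⊥ G e X δ∖ᴳX≡⊥ e∈δX =
  subst (Bond G) (⁅⁆≡tabulate e) (singleton-cut⇒bond G e (X , ⁅e⁆≡δX))
  where
  open ≡-Reasoning
  ⁅e⁆≡δX : ⁅ e ⁆ ≡ δ G X
  ⁅e⁆≡δX = begin
    ⁅ e ⁆                                        ≡⟨ insertAt-⊥ e ⟨
    insertAt ⊥ e inside                          ≡⟨ cong₂ (λ B b → insertAt B e b) δ∖ᴳX≡⊥ e∈δX ⟨
    insertAt (δ (G ∖ᴳ e) X) e (lookup (δ G X) e) ≡⟨ δ≡insertAt-δ∖ᴳ G e X ⟨
    δ G X                                        ∎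

δ∖ᴳ-determines-δ : (G : Graph n (suc m)) (e : Fin (suc m)) → ¬ Isthmus G e →
                   ∀ X Y → δ (G ∖ᴳ e) X ≡ δ (G ∖ᴳ e) Y → δ G X ≡ δ G Y
δ∖ᴳ-determines-δ G e ¬isthmus X Y δ∖ᴳ-agree with lookup (δ G X) e Bool.≟ lookup (δ G Y) e
... | yes e-agree = begin
  δ G X                                        ≡⟨ δ≡insertAt-δ∖ᴳ G e X ⟩
  insertAt (δ (G ∖ᴳ e) X) e (lookup (δ G X) e) ≡⟨ cong₂ (λ B b → insertAt B e b) δ∖ᴳ-agree e-agree ⟩
  insertAt (δ (G ∖ᴳ e) Y) e (lookup (δ G Y) e) ≡⟨ δ≡insertAt-δ∖ᴳ G e Y ⟨
  δ G Y                                        ∎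
  where open ≡-Reasoning
... | no e-differ = contradiction (isthmus-if-δ∖ᴳ≡⊥ G e X⊕Y δ∖ᴳX⊕Y≡⊥ e∈δX⊕Y) ¬isthmus
  where
  X⊕Y = zipWith _xor_ X Y
  δ∖ᴳX⊕Y≡⊥ : δ (G ∖ᴳ e) X⊕Y ≡ ⊥
  δ∖ᴳX⊕Y≡⊥ = trans (δ-xor (G ∖ᴳ e) X Y) (trans (cong (λ B → zipWith _xor_ B (δ (G ∖ᴳ e) Y)) δ∖ᴳ-agree)
                                                (zipWith-xor-self (δ (G ∖ᴳ e) Y)))
  e∈δX⊕Y : lookup (δ G X⊕Y) e ≡ true
  e∈δX⊕Y = trans (cong (λ B → lookup B e) (δ-xor G X Y))
                 (trans (lookup-zipWith _xor_ e (δ G X) (δ G Y)) (xor-≢ e-differ))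

bond∖ᴳ⇒bond : (G : Graph n (suc m)) (e : Fin (suc m)) → ¬ Isthmus G e →
              ∀ X → Bond (G ∖ᴳ e) (δ (G ∖ᴳ e) X) → Bond G (δ G X)
bond∖ᴳ⇒bond G e ¬isthmus X (_ , (i , i∈δ∖ᴳX) , minimal∖ᴳ) =
  (X , refl) , (punchIn e i , Equivalence.to (∈δ∖ᴳ⇔ G e X i) i∈δ∖ᴳX) , minimal
  where
  minimal : ∀ B → IsCut G B → Nonempty B → B ⊆ δ G X → B ≡ δ G X
  minimal B (Y , refl) δY≢∅ δY⊆δX with nonempty? (δ (G ∖ᴳ e) Y)
  ... | yes δ∖ᴳY≢∅ = δ∖ᴳ-determines-δ G e ¬isthmus Y X (minimal∖ᴳ _ (Y , refl) δ∖ᴳY≢∅ δ∖ᴳY⊆δ∖ᴳX)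
    where
    δ∖ᴳY⊆δ∖ᴳX : δ (G ∖ᴳ e) Y ⊆ δ (G ∖ᴳ e) X
    δ∖ᴳY⊆δ∖ᴳX {j} = Equivalence.from (∈δ∖ᴳ⇔ G e X j) ∘ δY⊆δX ∘ Equivalence.to (∈δ∖ᴳ⇔ G e Y j)
  ... | no δ∖ᴳY≡∅ = contradiction (subst Nonempty δY≡⊥ δY≢∅) λ (_ , x∈⊥) → ∉⊥ x∈⊥
    where
    δY≡⊥ : δ G Y ≡ ⊥
    δY≡⊥ = trans (δ∖ᴳ-determines-δ G e ¬isthmus Y ⊥ (trans (Empty-unique δ∖ᴳY≡∅) (sym (δ-⊥ (G ∖ᴳ e)))))
                 (δ-⊥ G)

-- Paths, and a cycle through every non-isthmus

Joins : Graph n m → Fin m → Bool → Fin n → Fin n → Set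
Joins G f true  u w = tl G f ≡ u × hd G f ≡ w
Joins G f false u w = hd G f ≡ u × tl G f ≡ w

joins-∖ᴳ : {G : Graph n (suc m)} {e : Fin (suc m)} {f : Fin m} {b : Bool} {u w : Fin n} →
           Joins (G ∖ᴳ e) f b u w → Joins G (punchIn e f) b u w
joins-∖ᴳ {b = true}  u-w = u-w
joins-∖ᴳ {b = false} u-w = u-w

joins-ends : {G : Graph n m} {f : Fin m} {b : Bool} {u w : Fin n} {S : Subset n} →
             Joins G f b u w → u ∈ S → w ∈ S → tl G f ∈ S × hd G f ∈ S
joins-ends {b = true}  (refl , refl) u∈S w∈S = u∈S , w∈S
joins-ends {b = false} (refl , refl) u∈S w∈S = w∈S , u∈S

joins-source : {G : Graph n m} {f : Fin m} {b : Bool} {u w : Fin n} →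
               Joins G f b u w → tl G f ≡ u ⊎ hd G f ≡ u
joins-source {b = true}  (tl≡u , _) = inj₁ tl≡u
joins-source {b = false} (hd≡u , _) = inj₂ hd≡u

record Path (G : Graph n m) (x y : Fin n) : Set where
  field
    length     : ℕ
    vertex     : Fin (suc length) → Fin n
    edge       : Fin length → Fin m
    forward    : Fin length → Bool
    vertex-inj : Injective _≡_ _≡_ vertex
    edge-inj   : Injective _≡_ _≡_ edge
    source     : vertex Fin.zero ≡ x
    target     : vertex (fromℕ length) ≡ y
    step       : ∀ i → Joins G (edge i) (forward i) (vertex (inject₁ i)) (vertex (Fin.suc i))

trivial-path : (G : Graph n m) (x : Fin n) → Path G x x
trivial-path G x = record
  { length = 0 ; vertex = λ _ → x ; edge = λ () ; forward = λ ()
  ; vertex-inj = λ { {Fin.zero} {Fin.zero} _ → refl } ; edge-inj = λ { {()} }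
  ; source = refl ; target = refl ; step = λ () }

prepend : {G : Graph n m} {x r y : Fin n} {f : Fin m} {b : Bool} (P : Path G x r) → Joins G f b y x →
          (∀ j → Path.vertex P j ≢ y) → (∀ i → Path.edge P i ≢ f) → Path G y r
prepend {G = G} {y = y} {f} {b} P y-x y-fresh f-fresh = record
  { length = suc length ; vertex = y Vector.∷ vertex ; edge = f Vector.∷ edge ; forward = b Vector.∷ forward
  ; vertex-inj = ∷-injective vertex-inj y-fresh ; edge-inj = ∷-injective edge-inj f-fresh
  ; source = refl ; target = target
  ; step = λ { Fin.zero → subst (Joins G f b y) (sym source) y-x ; (Fin.suc i) → step i } }
  where open Path P

crossing-edge : (G : Graph n m) (R : Subset n) (f : Fin m) → f ∈ δ G R →
                Σ Bool λ b → Σ (Fin n) λ y → Σ (Fin n) λ x → Joins G f b y x × y ∉ R × x ∈ R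
crossing-edge G R f f∈δR
  with lookup R (tl G f) in tl∈? | lookup R (hd G f) in hd∈? | trans (sym (δ-lookup G R f)) ([]=⇒lookup f∈δR)
... | true  | false | _ = false , hd G f , tl G f , (refl , refl) , lookup≡false⇒∉ hd∈? , lookup⇒[]= _ R tl∈?
... | false | true  | _ = true  , tl G f , hd G f , (refl , refl) , lookup≡false⇒∉ tl∈? , lookup⇒[]= _ R hd∈?
... | true  | true  | ()
... | false | false | ()

-- Breadth-first search from r: a set R of vertices, each joined to r by a path inside R, grows
-- along crossing edges until it contains t or no edge leaves it.
module PathSearch (G : Graph n m) (r t : Fin n) where

  Spanning : Subset n → Set
  Spanning R = ∀ {x} → x ∈ R → Σ (Path G x r) λ P → ∀ j → Path.vertex P j ∈ R

  Separating : Subset n → Set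
  Separating R = r ∈ R × t ∉ R × δ G R ≡ ⊥

  extend : ∀ {R f b y x} → Spanning R → Joins G f b y x → y ∉ R → x ∈ R →
           Σ (Path G y r) λ P → ∀ j → Path.vertex P j ∈ R ∪ ⁅ y ⁆
  extend {R} {f} {y = y} span y-x y∉R x∈R =
    prepend P y-x y-fresh f-fresh , λ { Fin.zero → q⊆p∪q R ⁅ y ⁆ (x∈⁅x⁆ y) ; (Fin.suc j) → p⊆p∪q ⁅ y ⁆ (P⊆R j) }
    where
    P = proj₁ (span x∈R)
    P⊆R = proj₂ (span x∈R)
    y-fresh : ∀ j → Path.vertex P j ≢ y
    y-fresh j refl = y∉R (P⊆R j)
    f-fresh : ∀ i → Path.edge P i ≢ f
    f-fresh i refl with joins-ends (Path.step P i) (P⊆R (inject₁ i)) (P⊆R (Fin.suc i)) | joins-source y-x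
    ... | tl∈R , _ | inj₁ refl = y∉R tl∈R
    ... | _ , hd∈R | inj₂ refl = y∉R hd∈R

  grow : ∀ {R f b y x} → Spanning R → Joins G f b y x → y ∉ R → x ∈ R → Spanning (R ∪ ⁅ y ⁆)
  grow {R} {y = y} span y-x y∉R x∈R z∈ with x∈p∪q⁻ R ⁅ y ⁆ z∈
  ... | inj₁ z∈R = proj₁ (span z∈R) , λ j → p⊆p∪q ⁅ y ⁆ (proj₂ (span z∈R) j)
  ... | inj₂ z∈⁅y⁆ rewrite x∈⁅y⁆⇒x≡y y z∈⁅y⁆ = extend span y-x y∉R x∈R

  search : ∀ R → Acc _⊃_ R → Spanning R → r ∈ R → Path G t r ⊎ Σ (Subset n) Separating
  search R (acc larger) span r∈R with t ∈? R
  ... | yes t∈R = inj₁ (proj₁ (span t∈R))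
  ... | no t∉R with nonempty? (δ G R)
  ...   | no δR≡∅ = inj₂ (R , r∈R , t∉R , Empty-unique δR≡∅)
  ...   | yes (f , f∈δR) with crossing-edge G R f f∈δR
  ...     | b , y , x , y-x , y∉R , x∈R =
    search (R ∪ ⁅ y ⁆) (larger (p⊆p∪q ⁅ y ⁆ , y , q⊆p∪q R ⁅ y ⁆ (x∈⁅x⁆ y) , y∉R))
           (grow span y-x y∉R x∈R) (p⊆p∪q ⁅ y ⁆ r∈R)

  path-or-separation : Path G t r ⊎ Σ (Subset n) Separating
  path-or-separation = search ⁅ r ⁆ (⊃-wellFounded ⁅ r ⁆) span₀ (x∈⁅x⁆ r)
    where
    span₀ : Spanning ⁅ r ⁆
    span₀ x∈⁅r⁆ rewrite x∈⁅y⁆⇒x≡y r x∈⁅r⁆ = trivial-path G r , λ _ → x∈⁅x⁆ r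

isthmus-if-separated : (G : Graph n (suc m)) (e : Fin (suc m)) (R : Subset n) →
                       tl G e ∈ R → hd G e ∉ R → δ (G ∖ᴳ e) R ≡ ⊥ → Isthmus G e
isthmus-if-separated G e R tl∈R hd∉R δ∖ᴳR≡⊥ = isthmus-if-δ∖ᴳ≡⊥ G e R δ∖ᴳR≡⊥ (begin
  lookup (δ G R) e                        ≡⟨ δ-lookup G R e ⟩
  lookup R (tl G e) xor lookup R (hd G e) ≡⟨ cong₂ _xor_ ([]=⇒lookup tl∈R) (¬-not (hd∉R ∘ lookup⇒[]= _ R)) ⟩
  true                                    ∎)
  where open ≡-Reasoning

close-path : (G : Graph n (suc m)) (e : Fin (suc m)) → Path (G ∖ᴳ e) (hd G e) (tl G e) → Cycle G
close-path G e P = record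
  { len = length ; v = vertex ; es = edge′ ; dir = forward′
  ; v-inj = vertex-inj ; es-inj = ∷ʳ-injective (edge-inj ∘ punchIn-injective e _ _) (punchInᵢ≢i e ∘ edge)
  ; along   = λ i d → subst (λ b → Joins G (edge′ i) b (vertex i) (vertex (next i))) d (closed-step i)
  ; against = λ i d → subst (λ b → Joins G (edge′ i) b (vertex i) (vertex (next i))) d (closed-step i) }
  where
  open Path P
  edge′ = (punchIn e ∘ edge) ∷ʳ e
  forward′ = forward ∷ʳ true
  closed-step : ∀ i → Joins G (edge′ i) (forward′ i) (vertex i) (vertex (next i))
  closed-step i with view i
  ... | ‵fromℕ rewrite next-fromℕ length = sym target , sym source
  ... | ‵inj₁ {i = j} _ rewrite next-inject₁ j = joins-∖ᴳ (step j)

cycle-through : (G : Graph n (suc m)) (e : Fin (suc m)) → ¬ Isthmus G e →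
                Σ (Cycle G) λ C → Σ (Fin (suc (len C))) λ i → es C i ≡ e × dir C i ≡ true
cycle-through G e ¬isthmus with PathSearch.path-or-separation (G ∖ᴳ e) (tl G e) (hd G e)
... | inj₁ P = close-path G e P , fromℕ _ , ∷ʳ-last (punchIn e ∘ Path.edge P) e , ∷ʳ-last (Path.forward P) true
... | inj₂ (R , tl∈R , hd∉R , δ∖ᴳR≡⊥) = contradiction (isthmus-if-separated G e R tl∈R hd∉R δ∖ᴳR≡⊥) ¬isthmus

cycle-step : {G : Graph n m} (C : Cycle G) (i : Fin (suc (len C))) →
             Joins G (es C i) (dir C i) (v C i) (v C (next i))
cycle-step C i with dir C i in d
... | true  = along C i d
... | false = against C i d

∖ᴸ-intro : ∀ {p} {L : Subset (suc m) → Set p} {e B} b → L (insertAt B e b) → (L ∖ᴸ e) B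
∖ᴸ-intro false = inj₁
∖ᴸ-intro true  = inj₂

∖ᴸ-elim : ∀ {p} {L : Subset (suc m) → Set p} {e B} → (L ∖ᴸ e) B → Σ Bool λ b → L (insertAt B e b)
∖ᴸ-elim (inj₁ B∈L) = false , B∈L
∖ᴸ-elim (inj₂ B∈L) = true , B∈L

DelBonds-cong : ∀ {p q} (G : Graph n (suc m)) (e : Fin (suc m))
                {L : Subset (suc m) → Set p} {L′ : Subset (suc m) → Set q} →
                L ≐ L′ → DelBonds G L e ≐ DelBonds G L′ e
DelBonds-cong G e L≐L′ B = mk⇔
  (λ (bond , B∈L∖e)  → bond , Sum.map (Equivalence.to (L≐L′ _)) (Equivalence.to (L≐L′ _)) B∈L∖e)
  (λ (bond , B∈L′∖e) → bond , Sum.map (Equivalence.from (L≐L′ _)) (Equivalence.from (L≐L′ _)) B∈L′∖e)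

-- Gains

module GainLemmas {c ℓ} (Γ : AbelianGroup c ℓ) where
  open AbelianGroup Γ
    renaming (Carrier to A; _∙_ to _+_; ε to 0#; _⁻¹ to -_; refl to ≈-refl; sym to ≈-sym; trans to ≈-trans;
              reflexive to ≈-reflexive)
  open AbelianGroupProperties Γ
  open CommutativeMonoidSum commutativeMonoid
    using (sum; sum-cong-≋; sum-cong-≗; ∑-comm; ∑-distrib-+; sum-remove; sum-init-last; sum-replicate-zero)
  open GainDefs Γ
  open SetoidReasoning setoid

  ∑≡sum : (f : Fin k → A) → ∑ f ≡ sum f
  ∑≡sum {zero}  f = refl
  ∑≡sum {suc k} f = cong (f Fin.zero +_) (∑≡sum (f ∘ Fin.suc))

  sum-homomorphic : (h : A → A) → (∀ {x y} → x ≈ y → h x ≈ h y) → h 0# ≈ 0# →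
                    (∀ x y → h (x + y) ≈ h x + h y) → (f : Fin k → A) → sum (h ∘ f) ≈ h (sum f)
  sum-homomorphic {zero}  h h-cong h-0 h-+ f = ≈-sym h-0
  sum-homomorphic {suc k} h h-cong h-0 h-+ f = begin
    h (f Fin.zero) + sum (h ∘ f ∘ Fin.suc) ≈⟨ ∙-congˡ (sum-homomorphic h h-cong h-0 h-+ (f ∘ Fin.suc)) ⟩
    h (f Fin.zero) + h (sum (f ∘ Fin.suc)) ≈⟨ h-+ _ _ ⟨
    h (sum f)                              ∎

  sum-neg : (f : Fin k → A) → sum (-_ ∘ f) ≈ - sum f
  sum-neg = sum-homomorphic -_ ⁻¹-cong ε⁻¹≈ε (λ x y → ≈-sym (⁻¹-∙-comm x y))

  sum-select : (j : Fin k) (g : Fin k → A) → (∀ i → i ≢ j → g i ≈ 0#) → sum g ≈ g j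
  sum-select {suc k} j g elsewhere-0 = begin
    sum g                     ≈⟨ sum-remove g ⟩
    g j + sum (g ∘ punchIn j) ≈⟨ ∙-congˡ (sum-cong-≋ (λ i → elsewhere-0 (punchIn j i) (punchInᵢ≢i j i))) ⟩
    g j + sum {k} (λ _ → 0#)  ≈⟨ ∙-congˡ (sum-replicate-zero k) ⟩
    g j + 0#                  ≈⟨ identityʳ (g j) ⟩
    g j                       ∎

  sum-rotate : (h : Fin (suc k) → A) → sum (h ∘ next) ≈ sum h
  sum-rotate {k} h = begin
    sum (h ∘ next)                                ≈⟨ sum-init-last (h ∘ next) ⟩
    sum (h ∘ next ∘ inject₁) + h (next (fromℕ k)) ≡⟨ cong₂ _+_ (sum-cong-≗ (cong h ∘ next-inject₁)) (cong h (next-fromℕ k)) ⟩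
    sum (h ∘ Fin.suc) + h Fin.zero                ≈⟨ comm _ _ ⟩
    sum h                                         ∎

  sum-telescope : (h : Fin (suc k) → A) → sum (λ i → h i + - h (next i)) ≈ 0#
  sum-telescope h = begin
    sum (λ i → h i + - h (next i)) ≈⟨ ∑-distrib-+ h (-_ ∘ h ∘ next) ⟩
    sum h + sum (-_ ∘ h ∘ next)    ≈⟨ ∙-congˡ (sum-neg (h ∘ next)) ⟩
    sum h + - sum (h ∘ next)       ≈⟨ ∙-congˡ (⁻¹-cong (sum-rotate h)) ⟩
    sum h + - sum h                ≈⟨ inverseʳ (sum h) ⟩
    0#                             ∎

  outward : Graph n m → Subset n → Fin m → A → A
  outward G X f y = if lookup (δ G X) f then (if lookup X (tl G f) then y else - y) else 0#

  indicator : Subset n → Fin n → A → A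
  indicator X u y = if lookup X u then y else 0#

  awaySum≡sum : (G : Graph n m) (φ : Gain m) (X : Subset n) → awaySum G φ X ≡ sum (λ f → outward G X f (φ f))
  awaySum≡sum G φ X = ∑≡sum (λ f → outward G X f (φ f))

  module _ (G : Graph n m) (X : Subset n) (f : Fin m) where

    outward-cong : ∀ {y z} → y ≈ z → outward G X f y ≈ outward G X f z
    outward-cong y≈z with lookup (δ G X) f | lookup X (tl G f)
    ... | true  | true  = y≈z
    ... | true  | false = ⁻¹-cong y≈z
    ... | false | _     = ≈-refl

    outward-0 : outward G X f 0# ≈ 0#
    outward-0 with lookup (δ G X) f | lookup X (tl G f)
    ... | true  | true  = ≈-refl
    ... | true  | false = ε⁻¹≈ε
    ... | false | _     = ≈-refl

    outward-+ : ∀ y z → outward G X f (y + z) ≈ outward G X f y + outward G X f z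
    outward-+ y z with lookup (δ G X) f | lookup X (tl G f)
    ... | true  | true  = ≈-refl
    ... | true  | false = ≈-sym (⁻¹-∙-comm y z)
    ... | false | _     = ≈-sym (identityˡ 0#)

    outward-sum : (g : Fin k → A) → outward G X f (sum g) ≈ sum (outward G X f ∘ g)
    outward-sum g = ≈-sym (sum-homomorphic (outward G X f) outward-cong outward-0 outward-+ g)

    outward-joins : ∀ {b u w} y → Joins G f b u w →
                    outward G X f (if b then y else - y) ≈ indicator X u y + - indicator X w y
    outward-joins {true} y (refl , refl) rewrite δ-lookup G X f
      with lookup X (tl G f) | lookup X (hd G f)
    ... | true  | true  = ≈-sym (inverseʳ y)
    ... | true  | false = ≈-sym (≈-trans (∙-congˡ ε⁻¹≈ε) (identityʳ y))
    ... | false | true  = ≈-sym (identityˡ (- y))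
    ... | false | false = ≈-sym (≈-trans (identityˡ (- 0#)) ε⁻¹≈ε)
    outward-joins {false} y (refl , refl) rewrite δ-lookup G X f
      with lookup X (tl G f) | lookup X (hd G f)
    ... | true  | true  = ≈-sym (inverseʳ y)
    ... | true  | false = ≈-sym (identityˡ (- y))
    ... | false | true  = ≈-trans (⁻¹-involutive y) (≈-sym (≈-trans (∙-congˡ ε⁻¹≈ε) (identityʳ y)))
    ... | false | false = ≈-sym (≈-trans (identityˡ (- 0#)) ε⁻¹≈ε)

  outward-∖ᴳ : (G : Graph n (suc m)) (e : Fin (suc m)) (X : Subset n) (j : Fin m) (y : A) →
               outward (G ∖ᴳ e) X j y ≡ outward G X (punchIn e j) y
  outward-∖ᴳ G e X j y =
    cong (λ b → if b then (if lookup X (tl G (punchIn e j)) then y else - y) else 0#) (δ∖ᴳ-lookup G e X j)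

  awaySum-cycGain : {G : Graph n m} (C : Cycle G) (a : A) (X : Subset n) → awaySum G (cycGain C a) X ≈ 0#
  awaySum-cycGain {G = G} C a X = begin
    awaySum G (cycGain C a) X                         ≡⟨ awaySum≡sum G (cycGain C a) X ⟩
    sum (λ f → outward G X f (cycGain C a f))         ≡⟨ sum-cong-≗ (λ f → cong (outward G X f) (∑≡sum (λ i → term i f))) ⟩
    sum (λ f → outward G X f (sum (λ i → term i f)))  ≈⟨ sum-cong-≋ (λ f → outward-sum G X f (λ i → term i f)) ⟩
    sum (λ f → sum (λ i → outward G X f (term i f)))  ≈⟨ ∑-comm (λ f i → outward G X f (term i f)) ⟩
    sum (λ i → sum (λ f → outward G X f (term i f)))  ≈⟨ sum-cong-≋ (λ i → sum-select (es C i) _ (off-edge i)) ⟩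
    sum (λ i → outward G X (es C i) (term i (es C i))) ≡⟨ sum-cong-≗ (λ i → cong (outward G X (es C i)) (if-≟-refl (es C i) {value i} {0#})) ⟩
    sum (λ i → outward G X (es C i) (value i))        ≈⟨ sum-cong-≋ (λ i → outward-joins G X (es C i) a (cycle-step C i)) ⟩
    sum (λ i → h i + - h (next i))                    ≈⟨ sum-telescope h ⟩
    0#                                                ∎
    where
    value : Fin (suc (len C)) → A
    value i = if dir C i then a else - a
    term : Fin (suc (len C)) → Fin _ → A
    term i f = if ⌊ es C i ≟ f ⌋ then value i else 0#
    h : Fin (suc (len C)) → A
    h i = indicator X (v C i) a
    off-edge : ∀ i f → f ≢ es C i → outward G X f (term i f) ≈ 0#
    off-edge i f f≢ = ≈-trans (outward-cong G X f (≈-reflexive (if-≟-≢ (f≢ ∘ sym)))) (outward-0 G X f)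

  cycGain-on-cycle : {G : Graph n m} (C : Cycle G) (a : A) (i : Fin (suc (len C))) →
                     dir C i ≡ true → cycGain C a (es C i) ≈ a
  cycGain-on-cycle C a i forward = begin
    cycGain C a (es C i)         ≡⟨ ∑≡sum term ⟩
    sum term                     ≈⟨ sum-select i term off-i ⟩
    term i                       ≡⟨ if-≟-refl (es C i) ⟩
    (if dir C i then a else - a) ≡⟨ cong (λ b → if b then a else - a) forward ⟩
    a                            ∎
    where
    term : Fin (suc (len C)) → A
    term j = if ⌊ es C j ≟ es C i ⌋ then (if dir C j then a else - a) else 0#
    off-i : ∀ j → j ≢ i → term j ≈ 0#
    off-i j j≢i = ≈-reflexive (if-≟-≢ (j≢i ∘ es-inj C))

  awaySum-shift : {G : Graph n m} {φ ψ : Gain m} → ShiftStep G φ ψ → ∀ X → awaySum G ψ X ≈ awaySum G φ X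
  awaySum-shift {G = G} {φ} {ψ} (C , a , ψ≈φ+cycGain) X = begin
    awaySum G ψ X                                  ≡⟨ awaySum≡sum G ψ X ⟩
    sum (λ f → outward G X f (ψ f))                ≈⟨ sum-cong-≋ (λ f → outward-cong G X f (ψ≈φ+cycGain f)) ⟩
    sum (λ f → outward G X f (φ f + cycGain C a f)) ≈⟨ sum-cong-≋ (λ f → outward-+ G X f (φ f) (cycGain C a f)) ⟩
    sum (λ f → out φ f + out (cycGain C a) f)      ≈⟨ ∑-distrib-+ (out φ) (out (cycGain C a)) ⟩
    sum (out φ) + sum (out (cycGain C a))          ≡⟨ cong₂ _+_ (awaySum≡sum G φ X) (awaySum≡sum G (cycGain C a) X) ⟨
    awaySum G φ X + awaySum G (cycGain C a) X      ≈⟨ ∙-congˡ (awaySum-cycGain C a X) ⟩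
    awaySum G φ X + 0#                             ≈⟨ identityʳ _ ⟩
    awaySum G φ X                                  ∎
    where
    out : Gain _ → Fin _ → A
    out χ f = outward G X f (χ f)

  awaySum-∖ᴳ : (G : Graph n (suc m)) (ψ : Gain (suc m)) (e : Fin (suc m)) → ψ e ≈ 0# →
               ∀ X → awaySum G ψ X ≈ awaySum (G ∖ᴳ e) (restrict ψ e) X
  awaySum-∖ᴳ G ψ e ψe≈0 X = begin
    awaySum G ψ X                                     ≡⟨ awaySum≡sum G ψ X ⟩
    sum out                                           ≈⟨ sum-remove {i = e} out ⟩
    out e + sum (out ∘ punchIn e)                     ≈⟨ ∙-congʳ (≈-trans (outward-cong G X e ψe≈0) (outward-0 G X e)) ⟩
    0# + sum (out ∘ punchIn e)                        ≈⟨ identityˡ _ ⟩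
    sum (out ∘ punchIn e)                             ≡⟨ sum-cong-≗ (λ j → outward-∖ᴳ G e X j (ψ (punchIn e j))) ⟨
    sum (λ j → outward (G ∖ᴳ e) X j (restrict ψ e j)) ≡⟨ awaySum≡sum (G ∖ᴳ e) (restrict ψ e) X ⟨
    awaySum (G ∖ᴳ e) (restrict ψ e) X                 ∎
    where
    out : Fin (suc _) → A
    out f = outward G X f (ψ f)

  𝓛-shift : {G : Graph n m} {φ ψ : Gain m} → ShiftStep G φ ψ → 𝓛 G φ ≐ 𝓛 G ψ
  𝓛-shift shift B = mk⇔
    (λ (bond , X , B≡δX , cob) → bond , X , B≡δX , ≈-trans (awaySum-shift shift X) cob)
    (λ (bond , X , B≡δX , cob) → bond , X , B≡δX , ≈-trans (≈-sym (awaySum-shift shift X)) cob)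

  DelBonds-𝓛 : (G : Graph n (suc m)) (e : Fin (suc m)) (ψ : Gain (suc m)) →
               ¬ Isthmus G e → ψ e ≈ 0# → DelBonds G (𝓛 G ψ) e ≐ 𝓛 (G ∖ᴳ e) (restrict ψ e)
  DelBonds-𝓛 G e ψ ¬isthmus ψe≈0 B = mk⇔ to from
    where
    to : DelBonds G (𝓛 G ψ) e B → 𝓛 (G ∖ᴳ e) (restrict ψ e) B
    to (bond , B∈𝓛∖e) with ∖ᴸ-elim {L = 𝓛 G ψ} B∈𝓛∖e
    ... | b , (_ , X , eq , cob) =
      bond , X , insertAt≡δ⇒≡δ∖ᴳ G e B b X eq , ≈-trans (≈-sym (awaySum-∖ᴳ G ψ e ψe≈0 X)) cob
    from : 𝓛 (G ∖ᴳ e) (restrict ψ e) B → DelBonds G (𝓛 G ψ) e B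
    from (bond , X , refl , cob) =
      bond , ∖ᴸ-intro {L = 𝓛 G ψ} (lookup (δ G X) e) (subst (𝓛 G ψ) (δ≡insertAt-δ∖ᴳ G e X) δX∈𝓛)
      where
      δX∈𝓛 : 𝓛 G ψ (δ G X)
      δX∈𝓛 = bond∖ᴳ⇒bond G e ¬isthmus X bond , X , refl , ≈-trans (awaySum-∖ᴳ G ψ e ψe≈0 X) cob

proposition4p11 : ∀ {c ℓ} (Γ : AbelianGroup c ℓ) {n m : ℕ}
    (G : Graph n (suc m)) (φ : GainDefs.Gain Γ (suc m)) (e : Fin (suc m)) →
    ¬ Isthmus G e →
    Σ (GainDefs.Gain Γ (suc m)) λ ψ →
      GainDefs.ShiftEquiv Γ G φ ψ
      × AbelianGroup._≈_ Γ (ψ e) (AbelianGroup.ε Γ)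
      × (DelBonds G (GainDefs.𝓛 Γ G φ) e ≐ DelBonds G (GainDefs.𝓛 Γ G ψ) e)
      × (DelBonds G (GainDefs.𝓛 Γ G ψ) e ≐ GainDefs.𝓛 Γ (G ∖ᴳ e) (GainDefs.restrict Γ ψ e))
proposition4p11 Γ G φ e ¬isthmus with cycle-through G e ¬isthmus
... | C , i , refl , forward =
  ψ , shift ◅ ε , ψe≈0 , DelBonds-cong G e (𝓛-shift shift) , DelBonds-𝓛 G e ψ ¬isthmus ψe≈0
  where
  open AbelianGroup Γ using (_≈_; ∙-congˡ; inverseʳ)
    renaming (_∙_ to _+_; _⁻¹ to -_; ε to 0#; refl to ≈-refl; trans to ≈-trans)
  open GainDefs Γ
  open GainLemmas Γ
  ψ : Gain _
  ψ f = φ f + cycGain C (- φ e) f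
  shift : ShiftStep G φ ψ
  shift = C , - φ e , λ _ → ≈-refl
  ψe≈0 : ψ e ≈ 0#
  ψe≈0 = ≈-trans (∙-congˡ (cycGain-on-cycle C (- φ e) i forward)) (inverseʳ (φ e))
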